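{- Let $\alpha$ be an infinite cardinal, $(Y,\le_Y)$ a local $\alpha$-quasilattice, and $y_*,y^*\in Y$ with $y_*\le_Y y^*$. Then the interval $I=[y_*,y^*]_Y=\{y\in Y: y_*\le_Y y\le_Y y^*\}$ is an $\alpha$-quasilattice with respect to the order induced from $Y$.
   Context: A subset of a poset is bounded if it has at least one lower bound and at least one upper bound. $(Y,\le_Y)$ is a local $\alpha$-quasilattice if for any two bounded $A,B\subseteq Y$ with $\max(|A|,|B|)<\alpha$ and $a\le_Y b$ for all $a\in A,b\in B$, there is $y^*\in Y$ with $a\le_Y y^*\le_Y b$ for all $a\in A,b\in B$. A poset $Z$ is an $\alpha$-quasilattice if the same holds for all (not necessarily bounded) $A,B\subseteq Z$ with $|A|,|B|<\alpha$ and $a\le b$ for all $a\in A,b\in B$. -}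

module Defs where

open import Level using (0ℓ)
open import Data.Nat using (ℕ)
open import Data.Fin using (Fin)
open import Data.Product using (Σ; _×_; _,_; proj₁)
open import Relation.Binary.Bundles using (Poset)
open import Relation.Binary.Structures using (IsPartialOrder; IsPreorder; IsEquivalence)
open import Relation.Binary.PropositionalEquality using (_≡_)
open import Relation.Nullary using (¬_)
open import Function.Bundles using (_↔_)

-- A cardinal α is represented as the cardinality |C| of a type C.
-- α is infinite: C is not in bijection with any Fin n.
Infinite : Set → Set
Infinite C = ∀ (n : ℕ) → ¬ (C ↔ Fin n)

module _ (P : Poset 0ℓ 0ℓ 0ℓ) where
  open Poset P

  Subset : Set₁
  Subset = Carrier → Set

  -- |A| ≤ |C| : an injection (elements counted up to the poset equality ≈)
  _≼_ : Subset → Set → Set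
  A ≼ C = Σ ((y : Carrier) → A y → C) λ f →
            ∀ {y y'} (p : A y) (p' : A y') → f y p ≡ f y' p' → y ≈ y'

  _≽_ : Subset → Set → Set
  A ≽ C = Σ (C → Σ Carrier A) λ g →
            ∀ c c' → proj₁ (g c) ≈ proj₁ (g c') → c ≡ c'

  _≺_ : Subset → Set → Set
  A ≺ C = (A ≼ C) × ¬ (A ≽ C)

  Bounded : Subset → Set
  Bounded A = (Σ Carrier λ l → ∀ y → A y → l ≤ y)
            × (Σ Carrier λ u → ∀ y → A y → y ≤ u)

  Below : Subset → Subset → Set
  Below A B = ∀ a b → A a → B b → a ≤ b

  Interpolant : Subset → Subset → Set
  Interpolant A B = Σ Carrier λ z → (∀ a → A a → a ≤ z) × (∀ b → B b → z ≤ b)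

-- local α-quasilattice (α = |C|); max(|A|,|B|) < α means |A| < α and |B| < α
IsLocalQuasilattice : Set → Poset 0ℓ 0ℓ 0ℓ → Set₁
IsLocalQuasilattice C P = ∀ (A B : Subset P) → Bounded P A → Bounded P B →
  _≺_ P A C → _≺_ P B C → Below P A B → Interpolant P A B

IsQuasilattice : Set → Poset 0ℓ 0ℓ 0ℓ → Set₁
IsQuasilattice C P = ∀ (A B : Subset P) →
  _≺_ P A C → _≺_ P B C → Below P A B → Interpolant P A B

Interval : (P : Poset 0ℓ 0ℓ 0ℓ) → Poset.Carrier P → Poset.Carrier P → Poset 0ℓ 0ℓ 0ℓ
Interval P lo hi = record
  { Carrier = Σ Carrier (λ y → lo ≤ y × y ≤ hi)
  ; _≈_ = λ x y → proj₁ x ≈ proj₁ y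
  ; _≤_ = λ x y → proj₁ x ≤ proj₁ y
  ; isPartialOrder = record
    { isPreorder = record
      { isEquivalence = record { refl = Eq.refl ; sym = Eq.sym ; trans = Eq.trans }
      ; reflexive = reflexive
      ; trans = trans
      }
    ; antisym = antisym
    }
  }
  where open Poset P

-- Every subset S of the interval I = [y₋, y⁺] is, viewed in Y, bounded by y₋ and y⁺, so the
-- local quasilattice property of Y interpolates between any two small separated subsets of I.
-- The interpolant lies in I as soon as both subsets are nonempty (it sits above some a ≥ y₋
-- and below some b ≤ y⁺); if one of them is empty, y₋ or y⁺ itself interpolates.
module Submission where

open import Defs
open import Level using (0ℓ)
open import Relation.Binary.Bundles using (Poset)
open import Axiom.ExcludedMiddle using (ExcludedMiddle)
open import Data.Empty using (⊥-elim)
open import Data.Product using (Σ; _×_; _,_; proj₁; proj₂)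
open import Relation.Nullary using (yes; no; ¬_)

module _ (P : Poset 0ℓ 0ℓ 0ℓ) (lo hi : Poset.Carrier P) where
  open Poset P

  private
    I : Poset 0ℓ 0ℓ 0ℓ
    I = Interval P lo hi

  Nonempty : Subset I → Set
  Nonempty S = Σ (Poset.Carrier I) S

  embed : Subset I → Subset P
  embed S y = Σ (lo ≤ y × y ≤ hi) λ p → S (y , p)

  embed-bounded : ∀ S → Bounded P (embed S)
  embed-bounded S = (lo , λ _ q → proj₁ (proj₁ q)) , (hi , λ _ q → proj₂ (proj₁ q))

  embed-≺ : ∀ {C} S → _≺_ I S C → _≺_ P (embed S) C
  embed-≺ S ((f , f-inj) , S⋡C) =
      ((λ y q → f (y , proj₁ q) (proj₂ q)) , λ q q′ → f-inj (proj₂ q) (proj₂ q′))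
    , λ (g , g-inj) → S⋡C ((λ c → (proj₁ (g c) , proj₁ (proj₂ (g c))) , proj₂ (proj₂ (g c))) , g-inj)

  embed-below : ∀ {A B} → Below I A B → Below P (embed A) (embed B)
  embed-below A≤B a b qa qb = A≤B (a , proj₁ qa) (b , proj₁ qb) (proj₂ qa) (proj₂ qb)

  interpolant-embed⇒interpolant : ∀ {A B} → Nonempty A → Nonempty B →
    Interpolant P (embed A) (embed B) → Interpolant I A B
  interpolant-embed⇒interpolant ((a , lo≤a , _) , a∈A) ((b , _ , b≤hi) , b∈B) (z , A≤z , z≤B) =
      (z , trans lo≤a (A≤z a (_ , a∈A)) , trans (z≤B b (_ , b∈B)) b≤hi)
    , (λ x x∈A → A≤z (proj₁ x) (proj₂ x , x∈A))
    , (λ x x∈B → z≤B (proj₁ x) (proj₂ x , x∈B))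

  interpolant-empty-lower : lo ≤ hi → ∀ {A} B → ¬ Nonempty A → Interpolant I A B
  interpolant-empty-lower lo≤hi B A-empty =
    (lo , refl , lo≤hi) , (λ a a∈A → ⊥-elim (A-empty (a , a∈A))) , (λ b _ → proj₁ (proj₂ b))

  interpolant-empty-upper : lo ≤ hi → ∀ A {B} → ¬ Nonempty B → Interpolant I A B
  interpolant-empty-upper lo≤hi A B-empty =
    (hi , lo≤hi , refl) , (λ a _ → proj₂ (proj₂ a)) , (λ b b∈B → ⊥-elim (B-empty (b , b∈B)))

lemma5p7 : ExcludedMiddle 0ℓ → (C : Set) → Infinite C →
    (Y : Poset 0ℓ 0ℓ 0ℓ) → IsLocalQuasilattice C Y →
    (y₋ y⁺ : Poset.Carrier Y) → Poset._≤_ Y y₋ y⁺ →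
    IsQuasilattice C (Interval Y y₋ y⁺)
lemma5p7 em C _ Y local y₋ y⁺ y₋≤y⁺ A B A≺C B≺C A≤B with em {Nonempty Y y₋ y⁺ A} | em {Nonempty Y y₋ y⁺ B}
... | no A-empty | _          = interpolant-empty-lower Y y₋ y⁺ y₋≤y⁺ B A-empty
... | yes _      | no B-empty = interpolant-empty-upper Y y₋ y⁺ y₋≤y⁺ A B-empty
... | yes a      | yes b      =
  interpolant-embed⇒interpolant Y y₋ y⁺ a b
    (local (embed Y y₋ y⁺ A) (embed Y y₋ y⁺ B)
      (embed-bounded Y y₋ y⁺ A) (embed-bounded Y y₋ y⁺ B)
      (embed-≺ Y y₋ y⁺ A A≺C) (embed-≺ Y y₋ y⁺ B B≺C)
      (embed-below Y y₋ y⁺ A≤B))
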